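{- Let $k\geq 1$ be an integer. Every bracelet graph with at least $4$ parts and at least $k+1$ vertices in each part is $(2k+1)$-ordered.
   Context: A graph $G$ is a bracelet graph if its vertex set can be partitioned into nonempty sets $V_1, \ldots, V_m$ with $m\geq 3$ (called the parts) such that two vertices $u\in V_i$ and $v\in V_j$ are adjacent if and only if $i-j\equiv 1$ or $-1 \pmod m$. A simple graph $G$ is $r$-ordered if, for every sequence $v_1, \ldots, v_r$ of $r$ distinct vertices of $G$, there exists a cycle in $G$ containing $v_1, \ldots, v_r$ in this (cyclic) order. -}

module Defs where

open import Data.Nat using (ℕ; zero; suc; _≤_; _%_)
open import Data.Fin using (Fin; toℕ)
open import Data.Fin.Properties using (_≟_)
open import Data.List using (List; []; _∷_; _++_; length; filter; allFin)
open import Data.List.Relation.Unary.Unique.Propositional using (Unique)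
open import Data.List.Relation.Unary.Linked using (Linked)
open import Data.List.Relation.Binary.Sublist.Propositional using (_⊆_)
open import Data.Product using (Σ; ∃; _×_)
open import Data.Sum using (_⊎_)
open import Data.Empty using (⊥)
open import Relation.Binary.PropositionalEquality using (_≡_)
open import Relation.Nullary using (¬_)
open import Function.Bundles using (_⇔_)
open import Level using (0ℓ)

record SimpleGraph (n : ℕ) : Set₁ where
  field
    Adj       : Fin n → Fin n → Set
    symmetric : ∀ {u v} → Adj u v → Adj v u
    irreflex  : ∀ {v} → ¬ Adj v v
open SimpleGraph public

CyclicNeighbours : (m : ℕ) → Fin m → Fin m → Set
CyclicNeighbours zero    i j = ⊥
CyclicNeighbours (suc m) i j =
  (toℕ i ≡ suc (toℕ j) % suc m) ⊎ (toℕ j ≡ suc (toℕ i) % suc m)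

partSize : ∀ {n m} → (Fin n → Fin m) → Fin m → ℕ
partSize {n} p i = length (filter (λ v → p v ≟ i) (allFin n))

IsBraceletPartition : ∀ {n} → SimpleGraph n → (m : ℕ) → (Fin n → Fin m) → Set
IsBraceletPartition {n} G m p =
  (3 ≤ m)
  × (∀ i → ∃ λ (v : Fin n) → p v ≡ i)
  × (∀ u v → Adj G u v ⇔ CyclicNeighbours m (p u) (p v))

-- A cycle, listed as its vertex sequence starting at some vertex in some direction:
-- at least 3 distinct vertices, consecutive ones adjacent, last adjacent to first.
IsCycle : ∀ {n} → SimpleGraph n → List (Fin n) → Set
IsCycle G []       = ⊥
IsCycle G (x ∷ xs) =
  (3 ≤ length (x ∷ xs)) × Unique (x ∷ xs) × Linked (Adj G) (x ∷ xs ++ x ∷ [])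

-- G is r-ordered: every sequence of r distinct vertices lies on some cycle in this
-- cyclic order (i.e. it is a subsequence of some listing of the cycle).
IsOrdered : ∀ {n} → ℕ → SimpleGraph n → Set
IsOrdered {n} r G =
  (vs : List (Fin n)) → length vs ≡ r → Unique vs →
  ∃ λ (c : List (Fin n)) → IsCycle G c × (vs ⊆ c)

-- Induction on k, over lists vs of 2k+1 distinct vertices. The cycle is first built over
-- the cycle C_M of parts, as a closed walk of tokens: the vertices of vs, and placeholders
-- `spare j t` standing for the t-th vertex of part j outside vs. A placeholder is valid when
-- t + |vs ∩ V_j| ≤ k, so parts with k+1 vertices leave room to replace all of them by
-- distinct actual vertices at the end.
--
-- For the step, write vs cyclically as a, b, c, rest, take a token cycle for a ∷ rest and
-- splice in, right after a, a detour made of b, c and new placeholders that visits b and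
-- then c. If all of vs lies in one part q, the detour is q+1, b, q-1, c. Otherwise at most
-- one part q holds more than k vertices of vs; taking b and c consecutive in vs, in
-- different parts and one of them in q, every other part has room for one more placeholder,
-- and the detour follows a route in C_M from the part of a through the parts of b and then
-- c, which exists because M ≥ 4.

{-# OPTIONS --safe #-}
module Submission where

open import Defs
open import Data.Nat using (ℕ; zero; suc; _+_; _*_; _∸_; _≤_; _<_; z≤n; s≤s; s≤s⁻¹; _≤?_)
open import Data.Nat.Properties
open import Data.Nat.DivMod
  using (_%_; _/_; _mod_; m≡m%n+[m/n]*n; %-distribˡ-+; m%n%n≡m%n; [m+n]%n≡m%n; m<n⇒m%n≡m; m%n<n)
open import Data.Fin using (Fin; toℕ)
open import Data.Fin.Properties using (toℕ-fromℕ<; toℕ-injective; toℕ<n; any?) renaming (_≟_ to _≟ᶠ_)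
open import Data.List
  using (List; []; _∷_; _++_; [_]; length; map; filter; allFin; initLast; _∷ʳ′_; applyUpTo; applyDownFrom)
open import Data.List.Properties
  using (++-assoc; ++-identityʳ; length-++; length-map; length-filter; filter-++; filter-all; filter-none;
         map-++; map-∘; map-id)
open import Data.List.Relation.Unary.All as All using (All; []; _∷_)
import Data.List.Relation.Unary.All.Properties as All
open import Data.List.Relation.Unary.All.Properties.Core using (¬All⇒Any¬)
open import Data.List.Relation.Unary.Any as Any using (Any; here; there)
import Data.List.Relation.Unary.Any.Properties as Any
open import Data.List.Relation.Unary.AllPairs using ([]; _∷_)
open import Data.List.Relation.Unary.Unique.Propositional using (Unique)
import Data.List.Relation.Unary.Unique.Propositional.Properties as Unique
open import Data.List.Relation.Unary.Linked as Linked using (Linked; [-]; _∷_)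
import Data.List.Relation.Unary.Linked.Properties as Linked
open import Data.List.Relation.Binary.Sublist.Propositional using (_⊆_; []; _∷_; _∷ʳ_; from∈)
import Data.List.Relation.Binary.Sublist.Propositional.Properties as Sublist
open import Data.List.Relation.Binary.Permutation.Propositional using (_↭_; ↭-sym; ↭⇒↭ₛ)
open import Data.List.Relation.Binary.Permutation.Propositional.Properties
  using (++-comm; All-resp-↭; ∈-resp-↭; ↭-length)
import Data.List.Relation.Binary.Permutation.Setoid.Properties as Permutation
open import Data.List.Membership.Propositional using (_∈_; _∉_)
open import Data.List.Membership.Propositional.Properties
  using (∈-∃++; ∈-++⁻; ∈-++⁺ˡ; ∈-++⁺ʳ; ∈-applyUpTo⁺; ∈-applyDownFrom⁺; ∈-filter⁺; ∈-filter⁻)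
open import Data.Product using (∃; ∃₂; _×_; _,_; proj₁; proj₂)
open import Data.Sum using (_⊎_; inj₁; inj₂)
open import Data.Empty using (⊥; ⊥-elim)
open import Function using (_∘_; _on_; case_of_)
open import Function.Bundles using (_⇔_; Equivalence)
open import Algebra.Properties.CommutativeSemigroup +-commutativeSemigroup using (x∙yz≈y∙xz)
open import Relation.Binary using (tri<; tri≈; tri>)
open import Relation.Binary.PropositionalEquality
  using (_≡_; _≢_; refl; sym; trans; cong; cong₂; subst; subst₂; setoid; module ≡-Reasoning)
open import Relation.Nullary using (¬_; ¬?; yes; no)
open import Relation.Unary using (Decidable; ∁)

module _ {A : Set} where

  linked-++⁺ : ∀ {R : A → A → Set} xs {y ys} →
               Linked R (xs ++ [ y ]) → Linked R (y ∷ ys) → Linked R (xs ++ y ∷ ys)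
  linked-++⁺ []            _         rs′ = rs′
  linked-++⁺ (x ∷ [])      (r ∷ [-]) rs′ = r ∷ rs′
  linked-++⁺ (x ∷ x′ ∷ xs) (r ∷ rs)  rs′ = r ∷ linked-++⁺ (x′ ∷ xs) rs rs′

  linked-++⁻ : ∀ {R : A → A → Set} xs {y ys} →
               Linked R (xs ++ y ∷ ys) → Linked R (xs ++ [ y ]) × Linked R (y ∷ ys)
  linked-++⁻ []            rs       = [-] , rs
  linked-++⁻ (x ∷ [])      (r ∷ rs) = r ∷ [-] , rs
  linked-++⁻ (x ∷ x′ ∷ xs) (r ∷ rs) with rs₁ , rs₂ ← linked-++⁻ (x′ ∷ xs) rs =
    r ∷ rs₁ , rs₂

  linked-applyUpTo : ∀ {R : A → A → Set} (f : ℕ → A) l {x e} →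
                     R x (f 0) → (∀ i → R (f i) (f (suc i))) → R (f l) e →
                     Linked R (x ∷ applyUpTo f (suc l) ++ [ e ])
  linked-applyUpTo f zero    r₀ _  rₑ = r₀ ∷ rₑ ∷ [-]
  linked-applyUpTo f (suc l) r₀ rs rₑ = r₀ ∷ linked-applyUpTo (f ∘ suc) l (rs 0) (rs ∘ suc) rₑ

  linked-applyDownFrom : ∀ {R : A → A → Set} (f : ℕ → A) l {x e} →
                         R x (f l) → (∀ i → R (f (suc i)) (f i)) → R (f 0) e →
                         Linked R (x ∷ applyDownFrom f (suc l) ++ [ e ])
  linked-applyDownFrom f zero    r₀ _  rₑ = r₀ ∷ rₑ ∷ [-]
  linked-applyDownFrom f (suc l) r₀ rs rₑ = r₀ ∷ linked-applyDownFrom f l (rs l) rs rₑ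

  ClosedWalk : (A → A → Set) → List A → Set
  ClosedWalk R []       = ⊥
  ClosedWalk R (x ∷ xs) = Linked R (x ∷ xs ++ [ x ])

  closedWalk-rotate : ∀ {R : A → A → Set} xs ys → ClosedWalk R (xs ++ ys) → ClosedWalk R (ys ++ xs)
  closedWalk-rotate []       ys       w = subst (ClosedWalk _) (sym (++-identityʳ ys)) w
  closedWalk-rotate (x ∷ xs) []       w = subst (ClosedWalk _) (++-identityʳ (x ∷ xs)) w
  closedWalk-rotate {R} (x ∷ xs) (y ∷ ys) w
    with w₁ , w₂ ← linked-++⁻ (x ∷ xs) (subst (Linked R) (cong (x ∷_) (++-assoc xs (y ∷ ys) [ x ])) w)
    = subst (Linked R) (cong (y ∷_) (sym (++-assoc ys (x ∷ xs) [ y ]))) (linked-++⁺ (y ∷ ys) w₂ w₁)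

  closedWalk-reroute : ∀ {R : A → A → Set} {x} zs → ClosedWalk R (x ∷ zs) →
                       ∃ λ z → R x z × (∀ {ds} → Linked R (x ∷ ds ++ [ z ]) → ClosedWalk R (x ∷ ds ++ zs))
  closedWalk-reroute {R} {x} [] (r ∷ [-]) =
    x , r , λ {ds} w → subst (λ ys → Linked R (x ∷ ys ++ [ x ])) (sym (++-identityʳ ds)) w
  closedWalk-reroute {R} {x} (z ∷ zs) (r ∷ w) =
    z , r , λ {ds} w′ →
      subst (Linked R ∘ (x ∷_)) (sym (++-assoc ds (z ∷ zs) [ x ])) (linked-++⁺ (x ∷ ds) w′ w)

  ⊆-∷-split : ∀ {x : A} {xs ws} → x ∷ xs ⊆ ws →
              ∃₂ λ ws₁ ws₂ → ws ≡ ws₁ ++ x ∷ ws₂ × xs ⊆ ws₂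
  ⊆-∷-split (w ∷ʳ τ) with ws₁ , ws₂ , refl , σ ← ⊆-∷-split τ = w ∷ ws₁ , ws₂ , refl , σ
  ⊆-∷-split (refl ∷ τ) = [] , _ , refl , τ

  ⊆-++-split : ∀ (xs : List A) {ys ws} → xs ++ ys ⊆ ws →
               ∃₂ λ ws₁ ws₂ → ws ≡ ws₁ ++ ws₂ × xs ⊆ ws₁ × ys ⊆ ws₂
  ⊆-++-split []       τ = [] , _ , refl , [] , τ
  ⊆-++-split (x ∷ xs) (w ∷ʳ τ) with ws₁ , ws₂ , refl , σ , ρ ← ⊆-++-split (x ∷ xs) τ =
    w ∷ ws₁ , ws₂ , refl , w ∷ʳ σ , ρ
  ⊆-++-split (x ∷ xs) (refl ∷ τ) with ws₁ , ws₂ , refl , σ , ρ ← ⊆-++-split xs τ =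
    x ∷ ws₁ , ws₂ , refl , refl ∷ σ , ρ

  pair⊆applyUpTo : ∀ (f : ℕ → A) {i j l} → i < j → j < l → f i ∷ f j ∷ [] ⊆ applyUpTo f l
  pair⊆applyUpTo f {zero}  {suc j} {suc l} _         (s≤s j<l) =
    refl ∷ from∈ (∈-applyUpTo⁺ (f ∘ suc) j<l)
  pair⊆applyUpTo f {suc i} {suc j} {suc l} (s≤s i<j) (s≤s j<l) =
    f 0 ∷ʳ pair⊆applyUpTo (f ∘ suc) i<j j<l

  pair⊆applyDownFrom : ∀ (f : ℕ → A) {i j l} → i < j → j < l → f j ∷ f i ∷ [] ⊆ applyDownFrom f l
  pair⊆applyDownFrom f {i} {j} {suc l} i<j (s≤s j≤l) with j ≟ l
  ... | yes refl = refl ∷ from∈ (∈-applyDownFrom⁺ f i<j)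
  ... | no j≢l   = f l ∷ʳ pair⊆applyDownFrom f i<j (≤∧≢⇒< j≤l j≢l)

  unique-↭ : ∀ {xs ys : List A} → xs ↭ ys → Unique xs → Unique ys
  unique-↭ σ = Permutation.Unique-resp-↭ (setoid A) (↭⇒↭ₛ σ)

  unique-splice : ∀ {P : A → Set} {x zs ds} → All P (x ∷ zs) → All (∁ P) ds →
                  Unique (x ∷ zs) → Unique ds → Unique (x ∷ ds ++ zs)
  unique-splice {P} (px ∷ pzs) ¬pds (x∉zs ∷ uzs) uds =
    All.++⁺ (All.map (λ ¬pd x≡d → ¬pd (subst P x≡d px)) ¬pds) x∉zs
    ∷ Unique.++⁺ uds uzs (λ (d∈ds , d∈zs) → All.lookup ¬pds d∈ds (All.lookup pzs d∈zs))

  unique-map-on : ∀ {B : Set} {P : A → Set} (f : A → B) →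
                  (∀ {x y} → P x → P y → f x ≡ f y → x ≡ y) →
                  ∀ {xs} → All P xs → Unique xs → Unique (map f xs)
  unique-map-on f inj []         []       = []
  unique-map-on f inj (px ∷ pxs) (x∉ ∷ u) =
    All.map⁺ (All.zipWith (λ (py , x≢y) fx≡fy → x≢y (inj px py fx≡fy)) (pxs , x∉))
    ∷ unique-map-on f inj pxs u

  unique-length-≤ : ∀ {xs ys : List A} → Unique xs → (∀ {x} → x ∈ xs → x ∈ ys) →
                    length xs ≤ length ys
  unique-length-≤ {[]}     _          _   = z≤n
  unique-length-≤ {x ∷ xs} (x∉xs ∷ u) sub with ys₁ , ys₂ , refl ← ∈-∃++ (sub (here refl)) =
    ≤-trans (s≤s (unique-length-≤ u sub′)) (≤-reflexive (sym length-remove))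
    where
    sub′ : ∀ {y} → y ∈ xs → y ∈ ys₁ ++ ys₂
    sub′ y∈xs with ∈-++⁻ ys₁ (sub (there y∈xs))
    ... | inj₁ y∈ys₁         = ∈-++⁺ˡ y∈ys₁
    ... | inj₂ (here refl)   = ⊥-elim (All.lookup x∉xs y∈xs refl)
    ... | inj₂ (there y∈ys₂) = ∈-++⁺ʳ ys₁ y∈ys₂
    length-remove : length (ys₁ ++ x ∷ ys₂) ≡ suc (length (ys₁ ++ ys₂))
    length-remove = trans (length-++ ys₁) (trans (+-suc _ _) (cong suc (sym (length-++ ys₁))))

  nonempty-All⇒Any : ∀ {P : A → Set} {xs} → 0 < length xs → All P xs → Any P xs
  nonempty-All⇒Any {xs = _ ∷ _} _ (px ∷ _) = here px

  Rotation : List A → List A → Set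
  Rotation xs ys = ∃₂ λ us ws → xs ≡ us ++ ws × ys ≡ ws ++ us

  rotation-↭ : ∀ {xs ys} → Rotation xs ys → xs ↭ ys
  rotation-↭ (us , ws , refl , refl) = ++-comm us ws

  rotation-from-predecessor : ∀ ys {b c : A} zs → 3 ≤ length (ys ++ b ∷ c ∷ zs) →
                              ∃₂ λ a rest → Rotation (ys ++ b ∷ c ∷ zs) (a ∷ b ∷ c ∷ rest)
  rotation-from-predecessor ys {b} {c} zs len with initLast ys | initLast zs
  ... | ys′ ∷ʳ′ a | _         =
    a , zs ++ ys′ , ys′ , a ∷ b ∷ c ∷ zs , ++-assoc ys′ [ a ] (b ∷ c ∷ zs) , refl
  ... | []        | zs′ ∷ʳ′ a = a , zs′ , b ∷ c ∷ zs′ , [ a ] , refl , refl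
  ... | []        | []        with s≤s (s≤s ()) ← len

  record Boundary (P : A → Set) (xs : List A) : Set where
    field
      before after : List A
      b c          : A
      split        : xs ≡ before ++ b ∷ c ∷ after
      straddles    : P b × ∁ P c ⊎ ∁ P b × P c

  module _ {P : A → Set} (P? : Decidable P) where

    private
      cons : ∀ {x xs} → Boundary P xs → Boundary P (x ∷ xs)
      cons {x} β = record
        { before = x ∷ before ; after = after ; split = cong (x ∷_) split ; straddles = straddles }
        where open Boundary β

      done : ∀ {x y zs} → P x × ∁ P y ⊎ ∁ P x × P y → Boundary P (x ∷ y ∷ zs)
      done s = record { before = [] ; split = refl ; straddles = s }

      boundary⁺ : ∀ {x xs} → P x → Any (∁ P) xs → Boundary P (x ∷ xs)
      boundary⁻ : ∀ {x xs} → ∁ P x → Any P xs → Boundary P (x ∷ xs)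
      boundary⁺ px (here ¬py) = done (inj₁ (px , ¬py))
      boundary⁺ {xs = y ∷ _} px (there any¬) with P? y
      ... | yes py = cons (boundary⁺ py any¬)
      ... | no ¬py = done (inj₁ (px , ¬py))
      boundary⁻ ¬px (here py) = done (inj₂ (¬px , py))
      boundary⁻ {xs = y ∷ _} ¬px (there any) with P? y
      ... | yes py = done (inj₂ (¬px , py))
      ... | no ¬py = cons (boundary⁻ ¬py any)

    boundary : ∀ {xs} → Any P xs → Any (∁ P) xs → Boundary P xs
    boundary {x ∷ _} any any¬ with P? x
    ... | yes px = boundary⁺ px (Any.tail (λ ¬px → ¬px px) any¬)
    ... | no ¬px = boundary⁻ ¬px (Any.tail ¬px any)

  lookupOr : A → List A → ℕ → A
  lookupOr d []       _       = d
  lookupOr d (x ∷ xs) zero    = x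
  lookupOr d (x ∷ xs) (suc i) = lookupOr d xs i

  lookupOr-All : ∀ {P : A → Set} {d} xs i → P d → All P xs → P (lookupOr d xs i)
  lookupOr-All []       _       pd _         = pd
  lookupOr-All (x ∷ xs) zero    _  (px ∷ _)  = px
  lookupOr-All (x ∷ xs) (suc i) pd (_ ∷ pxs) = lookupOr-All xs i pd pxs

  lookupOr-∈ : ∀ {d} xs {i} → i < length xs → lookupOr d xs i ∈ xs
  lookupOr-∈ (x ∷ xs) {zero}  _        = here refl
  lookupOr-∈ (x ∷ xs) {suc i} (s≤s i<) = there (lookupOr-∈ xs i<)

  lookupOr-injective : ∀ {d xs i j} → Unique xs → i < length xs → j < length xs →
                       lookupOr d xs i ≡ lookupOr d xs j → i ≡ j
  lookupOr-injective {xs = _ ∷ _}  {zero}  {zero}  _        _        _        _  = refl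
  lookupOr-injective {xs = _ ∷ xs} {zero}  {suc j} (x∉ ∷ _) _        (s≤s j<) eq =
    ⊥-elim (All.lookup x∉ (lookupOr-∈ xs j<) eq)
  lookupOr-injective {xs = _ ∷ xs} {suc i} {zero}  (x∉ ∷ _) (s≤s i<) _        eq =
    ⊥-elim (All.lookup x∉ (lookupOr-∈ xs i<) (sym eq))
  lookupOr-injective {xs = _ ∷ _}  {suc i} {suc j} (_ ∷ u)  (s≤s i<) (s≤s j<) eq =
    cong suc (lookupOr-injective u i< j< eq)

module Cycle (m : ℕ) where

  M : ℕ
  M = suc m

  _~_ : Fin M → Fin M → Set
  _~_ = CyclicNeighbours M

  ~-sym : ∀ {x y} → x ~ y → y ~ x
  ~-sym (inj₁ eq) = inj₂ eq
  ~-sym (inj₂ eq) = inj₁ eq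

  infixl 6 _⊕_
  _⊕_ : Fin M → ℕ → Fin M
  x ⊕ i = (toℕ x + i) mod M

  private
    toℕ-⊕ : ∀ x i → toℕ (x ⊕ i) ≡ (toℕ x + i) % M
    toℕ-⊕ x i = toℕ-fromℕ< _

    %-absorbˡ : ∀ a b → (a % M + b) % M ≡ (a + b) % M
    %-absorbˡ a b = begin
      (a % M + b) % M           ≡⟨ %-distribˡ-+ (a % M) b M ⟩
      (a % M % M + b % M) % M   ≡⟨ cong (λ t → (t + b % M) % M) (m%n%n≡m%n a M) ⟩
      (a % M + b % M) % M       ≡⟨ %-distribˡ-+ a b M ⟨
      (a + b) % M               ∎
      where open ≡-Reasoning

    -- r + d ≡ (r + d) % M + q * M, so r ≡ (r + d) % M forces d ≡ q * M.
    ≢-[+]% : ∀ r d → 0 < d → d < M → r ≢ (r + d) % M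
    ≢-[+]% r d 0<d d<M r≡ = multiple (+-cancelˡ-≡ r _ _ r+d≡r+q*M)
      where
      r+d≡r+q*M : r + d ≡ r + (r + d) / M * M
      r+d≡r+q*M = trans (m≡m%n+[m/n]*n (r + d) M) (cong (_+ (r + d) / M * M) (sym r≡))
      multiple : d ≢ (r + d) / M * M
      multiple eq with (r + d) / M
      ... | zero  = <⇒≢ 0<d (sym eq)
      ... | suc q = <⇒≱ d<M (subst (M ≤_) (sym eq) (m≤m+n M (q * M)))

    ≡suc%⇒≡⊕1 : ∀ {x y} → toℕ y ≡ suc (toℕ x) % M → y ≡ x ⊕ 1
    ≡suc%⇒≡⊕1 {x} eq =
      toℕ-injective (trans eq (trans (cong (_% M) (+-comm 1 (toℕ x))) (sym (toℕ-⊕ x 1))))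

  ⊕-assoc : ∀ x i j → x ⊕ i ⊕ j ≡ x ⊕ (i + j)
  ⊕-assoc x i j = toℕ-injective (begin
    toℕ (x ⊕ i ⊕ j)              ≡⟨ toℕ-⊕ (x ⊕ i) j ⟩
    (toℕ (x ⊕ i) + j) % M        ≡⟨ cong (λ t → (t + j) % M) (toℕ-⊕ x i) ⟩
    ((toℕ x + i) % M + j) % M    ≡⟨ %-absorbˡ (toℕ x + i) j ⟩
    (toℕ x + i + j) % M          ≡⟨ cong (_% M) (+-assoc (toℕ x) i j) ⟩
    (toℕ x + (i + j)) % M        ≡⟨ toℕ-⊕ x (i + j) ⟨
    toℕ (x ⊕ (i + j))            ∎)
    where open ≡-Reasoning

  ⊕-identityʳ : ∀ x → x ⊕ 0 ≡ x
  ⊕-identityʳ x = toℕ-injective (begin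
    toℕ (x ⊕ 0)         ≡⟨ toℕ-⊕ x 0 ⟩
    (toℕ x + 0) % M     ≡⟨ cong (_% M) (+-identityʳ (toℕ x)) ⟩
    toℕ x % M           ≡⟨ m<n⇒m%n≡m (toℕ<n x) ⟩
    toℕ x               ∎)
    where open ≡-Reasoning

  ⊕-period : ∀ x i → x ⊕ (M + i) ≡ x ⊕ i
  ⊕-period x i = toℕ-injective (begin
    toℕ (x ⊕ (M + i))        ≡⟨ toℕ-⊕ x (M + i) ⟩
    (toℕ x + (M + i)) % M    ≡⟨ cong (λ t → (toℕ x + t) % M) (+-comm M i) ⟩
    (toℕ x + (i + M)) % M    ≡⟨ cong (_% M) (+-assoc (toℕ x) i M) ⟨
    (toℕ x + i + M) % M      ≡⟨ [m+n]%n≡m%n (toℕ x + i) M ⟩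
    (toℕ x + i) % M          ≡⟨ toℕ-⊕ x i ⟨
    toℕ (x ⊕ i)              ∎)
    where open ≡-Reasoning

  ⊕-full : ∀ x → x ⊕ M ≡ x
  ⊕-full x = trans (cong (x ⊕_) (sym (+-identityʳ M))) (trans (⊕-period x 0) (⊕-identityʳ x))

  ⊕-wrap : ∀ x j → x ⊕ (m + suc j) ≡ x ⊕ j
  ⊕-wrap x j = trans (cong (x ⊕_) (+-suc m j)) (⊕-period x j)

  ⊕-injective : ∀ x i d → 0 < d → d < M → x ⊕ i ≢ x ⊕ (i + d)
  ⊕-injective x i d 0<d d<M eq = ≢-[+]% ((toℕ x + i) % M) d 0<d d<M (begin
    (toℕ x + i) % M               ≡⟨ toℕ-⊕ x i ⟨
    toℕ (x ⊕ i)                   ≡⟨ cong toℕ (trans eq (sym (⊕-assoc x i d))) ⟩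
    toℕ (x ⊕ i ⊕ d)               ≡⟨ toℕ-⊕ (x ⊕ i) d ⟩
    (toℕ (x ⊕ i) + d) % M         ≡⟨ cong (λ t → (t + d) % M) (toℕ-⊕ x i) ⟩
    ((toℕ x + i) % M + d) % M     ∎)
    where open ≡-Reasoning

  ⊕-surjective : ∀ x y → ∃ λ β → β < M × x ⊕ β ≡ y
  ⊕-surjective x y = β , m%n<n (M ∸ toℕ x + toℕ y) M , toℕ-injective (begin
    toℕ (x ⊕ β)                          ≡⟨ toℕ-⊕ x β ⟩
    (toℕ x + β) % M                      ≡⟨ cong (_% M) (+-comm (toℕ x) β) ⟩
    (β + toℕ x) % M                      ≡⟨ %-absorbˡ (M ∸ toℕ x + toℕ y) (toℕ x) ⟩
    (M ∸ toℕ x + toℕ y + toℕ x) % M      ≡⟨ cong (_% M) (+-comm (M ∸ toℕ x + toℕ y) (toℕ x)) ⟩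
    (toℕ x + (M ∸ toℕ x + toℕ y)) % M    ≡⟨ cong (_% M) (+-assoc (toℕ x) (M ∸ toℕ x) (toℕ y)) ⟨
    (toℕ x + (M ∸ toℕ x) + toℕ y) % M    ≡⟨ cong (λ t → (t + toℕ y) % M) (m+[n∸m]≡n x≤M) ⟩
    (M + toℕ y) % M                      ≡⟨ cong (_% M) (+-comm M (toℕ y)) ⟩
    (toℕ y + M) % M                      ≡⟨ [m+n]%n≡m%n (toℕ y) M ⟩
    toℕ y % M                            ≡⟨ m<n⇒m%n≡m (toℕ<n y) ⟩
    toℕ y                                ∎)
    where
    open ≡-Reasoning
    β = (M ∸ toℕ x + toℕ y) % M
    x≤M = <⇒≤ (toℕ<n x)

  ~-⊕1 : ∀ x → x ~ (x ⊕ 1)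
  ~-⊕1 x = inj₂ (trans (toℕ-⊕ x 1) (cong (_% M) (+-comm (toℕ x) 1)))

  ⊕-adjacent : ∀ x i → (x ⊕ i) ~ (x ⊕ suc i)
  ⊕-adjacent x i = subst ((x ⊕ i) ~_) (trans (⊕-assoc x i 1) (cong (x ⊕_) (+-comm i 1))) (~-⊕1 (x ⊕ i))

  ~-⊕m : ∀ x → x ~ (x ⊕ m)
  ~-⊕m x = ~-sym (subst ((x ⊕ m) ~_) (⊕-full x) (⊕-adjacent x m))

  ~-cases : ∀ {x e} → x ~ e → e ≡ x ⊕ 1 ⊎ e ≡ x ⊕ m
  ~-cases         (inj₂ eq) = inj₁ (≡suc%⇒≡⊕1 eq)
  ~-cases {x} {e} (inj₁ eq) = inj₂ (sym (begin
    x ⊕ m         ≡⟨ cong (_⊕ m) (≡suc%⇒≡⊕1 eq) ⟩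
    e ⊕ 1 ⊕ m     ≡⟨ ⊕-assoc e 1 m ⟩
    e ⊕ M         ≡⟨ ⊕-full e ⟩
    e             ∎))
    where open ≡-Reasoning

  record Route (x y z e : Fin M) : Set where
    field
      parts  : List (Fin M)
      linked : Linked _~_ (x ∷ parts ++ [ e ])
      unique : Unique parts
      visits : y ∷ z ∷ [] ⊆ parts

  private
    arc-adjacent : ∀ x c i → (x ⊕ (c + i)) ~ (x ⊕ (c + suc i))
    arc-adjacent x c i = subst ((x ⊕ (c + i)) ~_) (cong (x ⊕_) (sym (+-suc c i))) (⊕-adjacent x (c + i))

    arc-injective : ∀ x c {l i j} → l ≤ M → i < j → j < l → x ⊕ (c + i) ≢ x ⊕ (c + j)
    arc-injective x c {i = i} {j} l≤M i<j j<l eq =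
      ⊕-injective x (c + i) (j ∸ i) (m<n⇒0<n∸m i<j) (≤-<-trans (m∸n≤m j i) (<-≤-trans j<l l≤M))
        (trans eq (cong (x ⊕_) c+j≡c+i+[j∸i]))
      where
      c+j≡c+i+[j∸i] : c + j ≡ c + i + (j ∸ i)
      c+j≡c+i+[j∸i] = trans (cong (c +_) (sym (m+[n∸m]≡n (<⇒≤ i<j)))) (sym (+-assoc c i (j ∸ i)))

  upArc-route : ∀ {x y z e} c l {i j} → suc l ≤ M → x ~ (x ⊕ c) → (x ⊕ (c + l)) ~ e →
                i < j → j ≤ l → y ≡ x ⊕ (c + i) → z ≡ x ⊕ (c + j) → Route x y z e
  upArc-route {x} c l l<M x~first last~e i<j j≤l refl refl = record
    { parts  = applyUpTo arc (suc l)
    ; linked = linked-applyUpTo arc l (subst (x ~_) (cong (x ⊕_) (sym (+-identityʳ c))) x~first)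
                 (arc-adjacent x c) last~e
    ; unique = Unique.applyUpTo⁺₁ arc (suc l) (arc-injective x c l<M)
    ; visits = pair⊆applyUpTo arc i<j (s≤s j≤l)
    }
    where
    arc : ℕ → Fin M
    arc i = x ⊕ (c + i)

  downArc-route : ∀ {x y z e} c l {i j} → suc l ≤ M → x ~ (x ⊕ (c + l)) → (x ⊕ c) ~ e →
                  i < j → j ≤ l → y ≡ x ⊕ (c + j) → z ≡ x ⊕ (c + i) → Route x y z e
  downArc-route {x} {e = e} c l l<M x~first last~e i<j j≤l refl refl = record
    { parts  = applyDownFrom arc (suc l)
    ; linked = linked-applyDownFrom arc l x~first (~-sym ∘ arc-adjacent x c)
                 (subst (_~ e) (cong (x ⊕_) (sym (+-identityʳ c))) last~e)
    ; unique = Unique.applyDownFrom⁺₁ arc (suc l) (λ j<i i<l → arc-injective x c l<M j<i i<l ∘ sym)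
    ; visits = pair⊆applyDownFrom arc i<j (s≤s j≤l)
    }
    where
    arc : ℕ → Fin M
    arc i = x ⊕ (c + i)

module _ {m₀ : ℕ} where
  open Cycle (3 + m₀)

  private
    m : ℕ
    m = 3 + m₀

  ⊕1≢ : ∀ x → x ⊕ 1 ≢ x
  ⊕1≢ x eq = ⊕-injective x 0 1 (s≤s z≤n) (s≤s (s≤s z≤n)) (trans (⊕-identityʳ x) (sym eq))

  ⊕m≢ : ∀ x → x ⊕ m ≢ x
  ⊕m≢ x eq = ⊕-injective x 0 m (s≤s z≤n) ≤-refl (trans (⊕-identityʳ x) (sym eq))

  ⊕1≢⊕m : ∀ x → x ⊕ 1 ≢ x ⊕ m
  ⊕1≢⊕m x = ⊕-injective x 1 (2 + m₀) (s≤s z≤n) (s≤s (n≤1+n (2 + m₀)))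

  private
    4≤M : 4 ≤ M
    4≤M = s≤s (s≤s (s≤s (s≤s z≤n)))

    ⊕[2+m] : ∀ x → x ⊕ (2 + m) ≡ x ⊕ 1
    ⊕[2+m] x = trans (cong (x ⊕_) (+-comm 2 m)) (⊕-wrap x 1)

    ⊕[5+m₀] : ∀ x → x ⊕ ((2 + m₀) + 3) ≡ x ⊕ 1
    ⊕[5+m₀] x = trans (cong (x ⊕_) (+-comm (2 + m₀) 3)) (⊕[2+m] x)

    ⊕0≡⊕M : ∀ x → x ⊕ 0 ≡ x ⊕ M
    ⊕0≡⊕M x = trans (⊕-identityʳ x) (sym (⊕-full x))

    -- If y ≠ x, go once around the cycle in the direction that meets y
    -- before z. If y = x, step to e, back to x and once around away from e; when z = e this
    -- gets the order wrong, and the four parts x∓1, x, x±1, x±2 (for e = x±1) are used instead.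
    offsetRoute : ∀ x β γ {e} → β < M → γ < M → β ≢ γ → x ~ e → Route x (x ⊕ β) (x ⊕ γ) e
    offsetRoute x (suc β) γ β<M γ<M β≢γ x~e with <-cmp γ (suc β)
    ... | tri< γ<β _ _ =
      downArc-route 0 m ≤-refl (~-⊕m x) (subst (_~ _) (sym (⊕-identityʳ x)) x~e) γ<β (s≤s⁻¹ β<M) refl refl
    ... | tri≈ _ γ≡β _ = ⊥-elim (β≢γ (sym γ≡β))
    ... | tri> _ _ β<γ with suc γ′ ← γ =
      upArc-route 1 m ≤-refl (~-⊕1 x) (subst (_~ _) (sym (⊕-full x)) x~e)
        (s≤s⁻¹ β<γ) (<⇒≤ (s≤s⁻¹ γ<M)) refl refl
    offsetRoute x zero γ _ γ<M 0≢γ x~e with ~-cases x~e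
    offsetRoute x zero zero          _ _   0≢γ _ | _ = ⊥-elim (0≢γ refl)
    offsetRoute x zero (suc zero)    _ _   _   _ | inj₁ refl =
      upArc-route m 3 4≤M (~-⊕m x) (subst (_~ (x ⊕ 1)) (sym (⊕-wrap x 2)) (~-sym (⊕-adjacent x 1)))
        (s≤s (s≤s z≤n)) (s≤s (s≤s z≤n)) (sym (⊕-wrap x 0)) (sym (⊕-wrap x 1))
    offsetRoute x zero (suc (suc γ)) _ γ<M _   _ | inj₁ refl =
      downArc-route 2 m ≤-refl (subst (x ~_) (sym (⊕[2+m] x)) (~-⊕1 x)) (~-sym (⊕-adjacent x 1))
        (s≤s⁻¹ (s≤s⁻¹ γ<M)) (n≤1+n (2 + m₀)) (⊕0≡⊕M x) refl
    offsetRoute x zero (suc γ)       _ γ<M _   _ | inj₂ refl with suc γ ≟ m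
    ... | yes refl =
      downArc-route (2 + m₀) 3 4≤M (subst (x ~_) (sym (⊕[5+m₀] x)) (~-⊕1 x)) (⊕-adjacent x (2 + m₀))
        (s≤s (s≤s z≤n)) (s≤s (s≤s z≤n))
        (trans (⊕0≡⊕M x) (cong (x ⊕_) (+-comm 2 (2 + m₀)))) (cong (x ⊕_) (+-comm 1 (2 + m₀)))
    ... | no γ≢m =
      upArc-route m m ≤-refl (~-⊕m x) (subst ((x ⊕ (m + m)) ~_) (⊕-period x m) (⊕-adjacent x (m + m)))
        (s≤s (s≤s z≤n)) (≤∧≢⇒< (s≤s⁻¹ γ<M) γ≢m) (sym (⊕-wrap x 0)) (sym (⊕-wrap x (suc γ)))

  route : ∀ x y z e → y ≢ z → x ~ e → Route x y z e
  route x y z e y≢z x~e with ⊕-surjective x y | ⊕-surjective x z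
  ... | β , β<M , refl | γ , γ<M , refl = offsetRoute x β γ β<M γ<M (y≢z ∘ cong (x ⊕_)) x~e

module Tokens {n m₀ : ℕ} (p : Fin n → Fin (4 + m₀)) where
  open Cycle (3 + m₀)

  private
    m : ℕ
    m = 3 + m₀

  data Token : Set where
    vertex : Fin n → Token
    spare  : Fin M → ℕ → Token

  part : Token → Fin M
  part (vertex v)  = p v
  part (spare j _) = j

  _—_ : Token → Token → Set
  _—_ = _~_ on part

  count : Fin M → List (Fin n) → ℕ
  count j vs = length (filter (λ v → p v ≟ᶠ j) vs)

  Valid : ℕ → List (Fin n) → Token → Set
  Valid k vs (vertex v)  = v ∈ vs
  Valid k vs (spare j t) = t + count j vs ≤ k

  record TokenCycle (k : ℕ) (vs : List (Fin n)) : Set where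
    field
      tokens : List Token
      closed : ClosedWalk _—_ tokens
      unique : Unique tokens
      visits : map vertex vs ⊆ tokens
      valid  : All (Valid k vs) tokens

  count-++ : ∀ j xs ys → count j (xs ++ ys) ≡ count j xs + count j ys
  count-++ j xs ys = trans (cong length (filter-++ _ xs ys)) (length-++ (filter _ xs))

  count-rotation : ∀ j {xs ys} → Rotation xs ys → count j xs ≡ count j ys
  count-rotation j (us , ws , refl , refl) =
    trans (count-++ j us ws) (trans (+-comm (count j us) _) (sym (count-++ j ws us)))

  count-none : ∀ {j xs} → All (λ v → p v ≢ j) xs → count j xs ≡ 0
  count-none none = cong length (filter-none _ none)

  count-all : ∀ {j xs} → All (λ v → p v ≡ j) xs → count j xs ≡ length xs
  count-all all = cong length (filter-all _ all)

  count-pos : ∀ {j} xs → 0 < count j xs → Any (λ v → p v ≡ j) xs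
  count-pos {j} xs pos =
    Any.filter⁻ (λ v → p v ≟ᶠ j) (nonempty-All⇒Any pos (All.all-filter (λ v → p v ≟ᶠ j) xs))

  count-disjoint : ∀ {j q} → j ≢ q → ∀ xs → count j xs + count q xs ≤ length xs
  count-disjoint j≢q [] = z≤n
  count-disjoint {j} {q} j≢q (x ∷ xs) with p x ≟ᶠ j
  ... | yes refl with p x ≟ᶠ q
  ...   | yes px≡q = ⊥-elim (j≢q px≡q)
  ...   | no _     = s≤s (count-disjoint j≢q xs)
  count-disjoint {j} {q} j≢q (x ∷ xs) | no _ with p x ≟ᶠ q
  ...   | yes _ = subst (_≤ suc (length xs)) (sym (+-suc (count j xs) (count q xs)))
                    (s≤s (count-disjoint j≢q xs))
  ...   | no _  = m≤n⇒m≤1+n (count-disjoint j≢q xs)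

  valid-rotation : ∀ {k xs ys} → Rotation xs ys → ∀ t → Valid k ys t → Valid k xs t
  valid-rotation     ρ (vertex v)  v∈ = ∈-resp-↭ (↭-sym (rotation-↭ ρ)) v∈
  valid-rotation {k} ρ (spare j t) ok = subst (λ c → t + c ≤ k) (sym (count-rotation j ρ)) ok

  tokenCycle-rotation : ∀ {k xs ys} → Rotation xs ys → TokenCycle k ys → TokenCycle k xs
  tokenCycle-rotation ρ@(us , ws , refl , refl)
                      record { closed = closed ; unique = unique ; visits = visits ; valid = valid }
    with ws₁ , ws₂ , refl , ws⊆ , us⊆ ← ⊆-++-split (map vertex ws) (subst (_⊆ _) (map-++ vertex ws us) visits)
    = record
    { tokens = ws₂ ++ ws₁
    ; closed = closedWalk-rotate ws₁ ws₂ closed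
    ; unique = unique-↭ (++-comm ws₁ ws₂) unique
    ; visits = subst (_⊆ ws₂ ++ ws₁) (sym (map-++ vertex us ws)) (Sublist.++⁺ us⊆ ws⊆)
    ; valid  = All.map (valid-rotation ρ _) (All-resp-↭ (++-comm ws₁ ws₂) valid)
    }

  tokenCycle-singleton : ∀ v → TokenCycle 0 [ v ]
  tokenCycle-singleton v = record
    { tokens = vertex v ∷ spare (p v ⊕ 1) 0 ∷ []
    ; closed = ~-⊕1 (p v) ∷ ~-sym (~-⊕1 (p v)) ∷ [-]
    ; unique = ((λ ()) ∷ []) ∷ [] ∷ []
    ; visits = refl ∷ (_ ∷ʳ [])
    ; valid  = here refl ∷ ≤-reflexive (count-none ((⊕1≢ (p v) ∘ sym) ∷ [])) ∷ []
    }

  module Step {a b c : Fin n} {rest : List (Fin n)} (uvs : Unique (a ∷ b ∷ c ∷ rest)) where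

    us vs : List (Fin n)
    us = a ∷ rest
    vs = a ∷ b ∷ c ∷ rest

    unique-us : Unique us
    unique-us = case uvs of λ where ((_ ∷ _ ∷ a∉rest) ∷ _ ∷ _ ∷ urest) → a∉rest ∷ urest

    b∉us : b ∉ us
    b∉us (here b≡a)     = case uvs of λ where ((a≢b ∷ _) ∷ _) → a≢b (sym b≡a)
    b∉us (there b∈rest) = case uvs of λ where (_ ∷ (_ ∷ b∉rest) ∷ _) → All.lookup b∉rest b∈rest refl

    c∉us : c ∉ us
    c∉us (here c≡a)     = case uvs of λ where ((_ ∷ a≢c ∷ _) ∷ _) → a≢c (sym c≡a)
    c∉us (there c∈rest) = case uvs of λ where (_ ∷ _ ∷ c∉rest ∷ _) → All.lookup c∉rest c∈rest refl

    b≢c : b ≢ c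
    b≢c = case uvs of λ where (_ ∷ (b≢c ∷ _) ∷ _) → b≢c

    count-vs : ∀ j → count j vs ≡ count j (b ∷ c ∷ []) + count j us
    count-vs j = begin
      count j ([ a ] ++ bc ++ rest)                ≡⟨ count-++ j [ a ] (bc ++ rest) ⟩
      count j [ a ] + count j (bc ++ rest)         ≡⟨ cong (count j [ a ] +_) (count-++ j bc rest) ⟩
      count j [ a ] + (count j bc + count j rest)  ≡⟨ x∙yz≈y∙xz (count j [ a ]) (count j bc) (count j rest) ⟩
      count j bc + (count j [ a ] + count j rest)  ≡⟨ cong (count j bc +_) (count-++ j [ a ] rest) ⟨
      count j bc + count j us                      ∎
      where
      open ≡-Reasoning
      bc = b ∷ c ∷ []

    module _ {k : ℕ} where

      newSpare : Fin M → Token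
      newSpare j = spare j (suc k ∸ count j vs)

      newSpare-valid : ∀ j → count j vs ≤ suc k → Valid (suc k) vs (newSpare j)
      newSpare-valid j h = ≤-reflexive (m∸n+n≡m h)

      newSpare-fresh : ∀ j → p b ≢ j → p c ≢ j → count j vs ≤ suc k → ¬ Valid k us (newSpare j)
      newSpare-fresh j pb≢j pc≢j h ok = 1+n≰n (subst (_≤ k) suc-k ok)
        where
        suc-k : suc k ∸ count j vs + count j us ≡ suc k
        suc-k = trans (cong (suc k ∸ count j vs +_) (sym (trans (count-vs j)
                  (cong (_+ count j us) (count-none (pb≢j ∷ pc≢j ∷ [])))))) (m∸n+n≡m h)

      record Detour (z : Token) : Set where
        field
          tokens : List Token
          linked : Linked _—_ (vertex a ∷ tokens ++ [ z ])
          unique : Unique tokens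
          visits : vertex b ∷ vertex c ∷ [] ⊆ tokens
          valid  : All (Valid (suc k) vs) tokens
          fresh  : All (∁ (Valid k us)) tokens

      -- The alternative k < count j us means that no spare of part j is valid for us.
      extend : TokenCycle k us → (∀ {z} → p a ~ part z → Detour z) →
               (∀ j → count j (b ∷ c ∷ []) ≤ 1 ⊎ k < count j us) → TokenCycle (suc k) vs
      extend record { closed = closed ; unique = unique ; visits = visits ; valid = valid } detour slack
        with ws₁ , ws₂ , refl , rest⊆ ← ⊆-∷-split visits
        with z , a—z , reroute ←
               closedWalk-reroute (ws₂ ++ ws₁) (closedWalk-rotate ws₁ (vertex a ∷ ws₂) closed)
        = record
        { tokens = vertex a ∷ D.tokens ++ ws₂ ++ ws₁
        ; closed = reroute D.linked
        ; unique = unique-splice valid-old D.fresh (unique-↭ (++-comm ws₁ _) unique) D.unique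
        ; visits = refl ∷ Sublist.++⁺ D.visits (Sublist.++⁺ʳ ws₁ rest⊆)
        ; valid  = here refl ∷ All.++⁺ D.valid (All.map (lift _) (All.tail valid-old))
        }
        where
        module D = Detour (detour {z} a—z)

        valid-old : All (Valid k us) (vertex a ∷ ws₂ ++ ws₁)
        valid-old = All-resp-↭ (++-comm ws₁ (vertex a ∷ ws₂)) valid

        lift : ∀ t → Valid k us t → Valid (suc k) vs t
        lift (vertex v)  (here v≡a) = here v≡a
        lift (vertex v)  (there v∈) = there (there (there v∈))
        lift (spare j t) ok with slack j
        ... | inj₁ ≤1      = begin
          t + count j vs                          ≡⟨ cong (t +_) (count-vs j) ⟩
          t + (count j (b ∷ c ∷ []) + count j us) ≤⟨ +-monoʳ-≤ t (+-monoˡ-≤ (count j us) ≤1) ⟩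
          t + suc (count j us)                    ≡⟨ +-suc t (count j us) ⟩
          suc (t + count j us)                    ≤⟨ s≤s ok ⟩
          suc k                                   ∎
          where open ≤-Reasoning
        ... | inj₂ crowded = ⊥-elim (<⇒≱ crowded (≤-trans (m≤n+m _ t) ok))

      bounce : All (λ v → p v ≡ p a) vs → k < count (p a) us → TokenCycle k us → TokenCycle (suc k) vs
      bounce same@(_ ∷ pb≡q ∷ pc≡q ∷ _) crowded C = extend C detour slack
        where
        q = p a

        outside : ∀ {j v} → j ≢ q → p v ≡ q → p v ≢ j
        outside j≢q pv≡q pv≡j = j≢q (trans (sym pv≡j) pv≡q)

        sparse : ∀ {j} → j ≢ q → count j vs ≤ suc k
        sparse j≢q = subst (_≤ suc k) (sym (count-none (All.map (outside j≢q) same))) z≤n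

        fresh : ∀ {j} → j ≢ q → ¬ Valid k us (newSpare j)
        fresh j≢q = newSpare-fresh _ (outside j≢q pb≡q) (outside j≢q pc≡q) (sparse j≢q)

        detour : ∀ {z} → q ~ part z → Detour z
        detour {z} q~z = record
          { tokens = newSpare (q ⊕ 1) ∷ vertex b ∷ newSpare (q ⊕ m) ∷ vertex c ∷ []
          ; linked = ~-⊕1 q
                   ∷ subst ((q ⊕ 1) ~_) (sym pb≡q) (~-sym (~-⊕1 q))
                   ∷ subst (_~ (q ⊕ m)) (sym pb≡q) (~-⊕m q)
                   ∷ subst ((q ⊕ m) ~_) (sym pc≡q) (~-sym (~-⊕m q))
                   ∷ subst (_~ part z) (sym pc≡q) q~z
                   ∷ [-]
          ; unique = ((λ ()) ∷ ⊕1≢⊕m q ∘ cong part ∷ (λ ()) ∷ [])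
                   ∷ ((λ ()) ∷ (λ { refl → b≢c refl }) ∷ [])
                   ∷ ((λ ()) ∷ [])
                   ∷ []
                   ∷ []
          ; visits = _ ∷ʳ refl ∷ _ ∷ʳ refl ∷ []
          ; valid  = newSpare-valid _ (sparse (⊕1≢ q)) ∷ there (here refl)
                   ∷ newSpare-valid _ (sparse (⊕m≢ q)) ∷ there (there (here refl)) ∷ []
          ; fresh  = fresh (⊕1≢ q) ∷ b∉us ∷ fresh (⊕m≢ q) ∷ c∉us ∷ []
          }

        slack : ∀ j → count j (b ∷ c ∷ []) ≤ 1 ⊎ k < count j us
        slack j with j ≟ᶠ q
        ... | yes refl = inj₂ crowded
        ... | no j≢q   =
          inj₁ (≤-trans (≤-reflexive (count-none (outside j≢q pb≡q ∷ outside j≢q pc≡q ∷ []))) z≤n)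

      viaRoute : p b ≢ p c → (∀ j → p b ≢ j → p c ≢ j → count j vs ≤ suc k) →
                 TokenCycle k us → TokenCycle (suc k) vs
      viaRoute pb≢pc light C = extend C detour (inj₁ ∘ slack)
        where
        token : Fin M → Token
        token j with p b ≟ᶠ j | p c ≟ᶠ j
        ... | yes _   | _       = vertex b
        ... | no _    | yes _   = vertex c
        ... | no pb≢j | no pc≢j = newSpare j

        part-token : ∀ j → part (token j) ≡ j
        part-token j with p b ≟ᶠ j | p c ≟ᶠ j
        ... | yes pb≡j | _        = pb≡j
        ... | no _     | yes pc≡j = pc≡j
        ... | no _     | no _     = refl

        token-b : token (p b) ≡ vertex b
        token-b with p b ≟ᶠ p b
        ... | yes _    = refl
        ... | no pb≢pb = ⊥-elim (pb≢pb refl)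

        token-c : token (p c) ≡ vertex c
        token-c with p b ≟ᶠ p c | p c ≟ᶠ p c
        ... | yes pb≡pc | _        = ⊥-elim (pb≢pc pb≡pc)
        ... | no _      | yes _    = refl
        ... | no _      | no pc≢pc = ⊥-elim (pc≢pc refl)

        token-valid : ∀ j → Valid (suc k) vs (token j)
        token-valid j with p b ≟ᶠ j | p c ≟ᶠ j
        ... | yes _   | _       = there (here refl)
        ... | no _    | yes _   = there (there (here refl))
        ... | no pb≢j | no pc≢j = newSpare-valid j (light j pb≢j pc≢j)

        token-fresh : ∀ j → ¬ Valid k us (token j)
        token-fresh j with p b ≟ᶠ j | p c ≟ᶠ j
        ... | yes _   | _       = b∉us
        ... | no _    | yes _   = c∉us
        ... | no pb≢j | no pc≢j = newSpare-fresh j pb≢j pc≢j (light j pb≢j pc≢j)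

        map-part-token : ∀ js → map part (map token js) ≡ js
        map-part-token []       = refl
        map-part-token (j ∷ js) = cong₂ _∷_ (part-token j) (map-part-token js)

        detour : ∀ {z} → p a ~ part z → Detour z
        detour {z} a~z = record
          { tokens = map token parts
          ; linked = Linked.map⁻ (subst (Linked _~_) (sym walk-parts) linked)
          ; unique = Unique.map⁺ (λ {i} {j} eq → trans (sym (part-token i)) (trans (cong part eq) (part-token j)))
                       unique
          ; visits = subst₂ (λ tb tc → tb ∷ tc ∷ [] ⊆ map token parts) token-b token-c
                       (Sublist.map⁺ token visits)
          ; valid  = All.map⁺ (All.universal token-valid parts)
          ; fresh  = All.map⁺ (All.universal token-fresh parts)
          }
          where
          open Route (route (p a) (p b) (p c) (part z) pb≢pc a~z)
          walk-parts : map part (vertex a ∷ map token parts ++ [ z ]) ≡ p a ∷ parts ++ [ part z ]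
          walk-parts = cong (p a ∷_) (trans (map-++ part (map token parts) [ z ])
                                            (cong (_++ [ part z ]) (map-part-token parts)))

        slack : ∀ j → count j (b ∷ c ∷ []) ≤ 1
        slack j with p b ≟ᶠ j
        ... | yes refl = s≤s (≤-reflexive (count-none (pb≢pc ∘ sym ∷ [])))
        ... | no _     = length-filter (λ v → p v ≟ᶠ j) (c ∷ [])

  dominantPart : ∀ k {v vs} → length (v ∷ vs) ≡ suc (k + k) →
                 ∃ λ q → Any (λ u → p u ≡ q) (v ∷ vs) × (∀ j → j ≢ q → count j (v ∷ vs) ≤ k)
  dominantPart k {v} {vs} len with any? (λ j → suc k ≤? count j (v ∷ vs))
  ... | yes (q , crowded) = q , count-pos (v ∷ vs) (≤-trans (s≤s z≤n) crowded) , light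
    where
    light : ∀ j → j ≢ q → count j (v ∷ vs) ≤ k
    light j j≢q = +-cancelʳ-≤ (suc k) (count j (v ∷ vs)) k (begin
      count j (v ∷ vs) + suc k                 ≤⟨ +-monoʳ-≤ (count j (v ∷ vs)) crowded ⟩
      count j (v ∷ vs) + count q (v ∷ vs)      ≤⟨ count-disjoint j≢q (v ∷ vs) ⟩
      length (v ∷ vs)                          ≡⟨ trans len (sym (+-suc k k)) ⟩
      k + suc k                                ∎)
      where open ≤-Reasoning
  ... | no none = p v , here refl , λ j _ → ≤-pred (≰⇒> (λ crowded → none (j , crowded)))

  record Anchoring (k : ℕ) (vs : List (Fin n)) : Set where
    field
      a b c    : Fin n
      rest     : List (Fin n)
      rotation : Rotation vs (a ∷ b ∷ c ∷ rest)
      distinct : p b ≢ p c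
      light    : ∀ j → p b ≢ j → p c ≢ j → count j vs ≤ k

  private
    3≤3+k+k : ∀ k → 3 ≤ suc (suc k + suc k)
    3≤3+k+k k = s≤s (s≤s (≤-trans (s≤s z≤n) (m≤n+m (suc k) k)))

  anchoring : ∀ k {v vs} → length (v ∷ vs) ≡ suc (suc k + suc k) →
              (∀ q → ¬ All (λ u → p u ≡ q) (v ∷ vs)) → Anchoring (suc k) (v ∷ vs)
  anchoring k {v} {vs} len spread
    with q , inQ , light ← dominantPart (suc k) len
    with β ← boundary (λ u → p u ≟ᶠ q) inQ (¬All⇒Any¬ (λ u → p u ≟ᶠ q) (v ∷ vs) (spread q))
    with a , rest , ρ ← rotation-from-predecessor (Boundary.before β) (Boundary.after β)
                          (subst (λ ws → 3 ≤ length ws) (Boundary.split β) (subst (3 ≤_) (sym len) (3≤3+k+k k)))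
    = record
    { a = a ; b = b ; c = c ; rest = rest
    ; rotation = subst (λ ws → Rotation ws (a ∷ b ∷ c ∷ rest)) (sym split) ρ
    ; distinct = distinct straddles
    ; light    = λ j pb≢j pc≢j → light j (avoids straddles pb≢j pc≢j)
    }
    where
    open Boundary β
    distinct : p b ≡ q × p c ≢ q ⊎ p b ≢ q × p c ≡ q → p b ≢ p c
    distinct (inj₁ (pb≡q , pc≢q)) pb≡pc = pc≢q (trans (sym pb≡pc) pb≡q)
    distinct (inj₂ (pb≢q , pc≡q)) pb≡pc = pb≢q (trans pb≡pc pc≡q)
    avoids : ∀ {j} → p b ≡ q × p c ≢ q ⊎ p b ≢ q × p c ≡ q → p b ≢ j → p c ≢ j → j ≢ q
    avoids (inj₁ (pb≡q , _)) pb≢j _    j≡q = pb≢j (trans pb≡q (sym j≡q))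
    avoids (inj₂ (_ , pc≡q)) _    pc≢j j≡q = pc≢j (trans pc≡q (sym j≡q))

  AllTokenCycles : ℕ → Set
  AllTokenCycles k = ∀ vs → length vs ≡ suc (k + k) → Unique vs → TokenCycle k vs

  private
    length-drop₂ : ∀ {k} (rest : List (Fin n)) → 3 + length rest ≡ suc (suc k + suc k) →
                   1 + length rest ≡ suc (k + k)
    length-drop₂ {k} _ len = cong suc (suc-injective (trans (suc-injective (suc-injective len)) (+-suc k k)))

  uniformStep : ∀ {k} → AllTokenCycles k → ∀ {a b c rest} →
                length (a ∷ b ∷ c ∷ rest) ≡ suc (suc k + suc k) → Unique (a ∷ b ∷ c ∷ rest) →
                All (λ u → p u ≡ p a) (a ∷ b ∷ c ∷ rest) → TokenCycle (suc k) (a ∷ b ∷ c ∷ rest)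
  uniformStep {k} IH {a} {rest = rest} len uvs same@(pa≡pa ∷ _ ∷ _ ∷ prest≡pa) =
    Step.bounce uvs same crowded (IH (a ∷ rest) len′ (Step.unique-us uvs))
    where
    len′ = length-drop₂ rest len
    crowded : k < count (p a) (a ∷ rest)
    crowded = subst (k <_) (sym (trans (count-all (pa≡pa ∷ prest≡pa)) len′)) (s≤s (m≤m+n k k))

  mixedStep : ∀ {k} → AllTokenCycles k → ∀ {v vs} →
              length (v ∷ vs) ≡ suc (suc k + suc k) → Unique (v ∷ vs) →
              (∀ q → ¬ All (λ u → p u ≡ q) (v ∷ vs)) → TokenCycle (suc k) (v ∷ vs)
  mixedStep {k} IH len uvs spread =
    tokenCycle-rotation rotation (Step.viaRoute uvs′ distinct light′ (IH (a ∷ rest) len′ (Step.unique-us uvs′)))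
    where
    open Anchoring (anchoring k len spread)
    uvs′ : Unique (a ∷ b ∷ c ∷ rest)
    uvs′ = unique-↭ (rotation-↭ rotation) uvs
    len′ : length (a ∷ rest) ≡ suc (k + k)
    len′ = length-drop₂ rest (trans (sym (↭-length (rotation-↭ rotation))) len)
    light′ : ∀ j → p b ≢ j → p c ≢ j → count j (a ∷ b ∷ c ∷ rest) ≤ suc k
    light′ j pb≢j pc≢j = subst (_≤ suc k) (count-rotation j rotation) (light j pb≢j pc≢j)

  tokenCycle : ∀ k → AllTokenCycles k
  tokenCycle zero    (v ∷ [])                 _   _   = tokenCycle-singleton v
  tokenCycle (suc k) (_ ∷ _ ∷ [])             len _   =
    ⊥-elim (0≢1+n (trans (suc-injective (suc-injective len)) (+-suc k k)))
  tokenCycle (suc k) vs@(a ∷ b ∷ c ∷ rest) len uvs with All.all? (λ u → p u ≟ᶠ p a) vs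
  ... | yes same  = uniformStep (tokenCycle k) len uvs same
  ... | no  mixed = mixedStep (tokenCycle k) len uvs spread
    where
    spread : ∀ q → ¬ All (λ u → p u ≡ q) vs
    spread q all = mixed (All.map (λ pu≡q → trans pu≡q (sym (All.head all))) all)

module Realisation {n m₀ : ℕ} (G : SimpleGraph n) (p : Fin n → Fin (4 + m₀))
                   (adj : ∀ u v → Adj G u v ⇔ CyclicNeighbours (4 + m₀) (p u) (p v))
                   (inhabited : ∀ j → ∃ λ v → p v ≡ j)
                   {k : ℕ} (large : ∀ j → suc k ≤ partSize p j)
                   (vs : List (Fin n)) where
  open Tokens p
  open import Data.List.Membership.DecPropositional (_≟ᶠ_ {n}) using (_∈?_)

  members : Fin (4 + m₀) → List (Fin n)
  members j = filter (λ v → p v ≟ᶠ j) (allFin n)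

  spares : Fin (4 + m₀) → List (Fin n)
  spares j = filter (λ v → ¬? (v ∈? vs)) (members j)

  members-unique : ∀ j → Unique (members j)
  members-unique j = Unique.filter⁺ _ (Unique.allFin⁺ n)

  spares-long : ∀ {j t} → t + count j vs ≤ k → t < length (spares j)
  spares-long {j} {t} ok = +-cancelʳ-< (count j vs) t (length (spares j)) (begin-strict
    t + count j vs                                   <⟨ s≤s ok ⟩
    suc k                                            ≤⟨ large j ⟩
    length (members j)                               ≤⟨ unique-length-≤ (members-unique j) cover ⟩
    length (spares j ++ filter (λ v → p v ≟ᶠ j) vs)  ≡⟨ length-++ (spares j) ⟩
    length (spares j) + count j vs                   ∎)
    where
    open ≤-Reasoning
    cover : ∀ {v} → v ∈ members j → v ∈ spares j ++ filter (λ v → p v ≟ᶠ j) vs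
    cover {v} v∈ with v ∈? vs
    ... | yes v∈vs =
      ∈-++⁺ʳ (spares j) (∈-filter⁺ _ v∈vs (proj₂ (∈-filter⁻ (λ v → p v ≟ᶠ j) {xs = allFin n} v∈)))
    ... | no  v∉vs = ∈-++⁺ˡ (∈-filter⁺ (λ v → ¬? (v ∈? vs)) v∈ v∉vs)

  -- The default lies in part j, so that part-realise also holds for invalid spares.
  realise : Token → Fin n
  realise (vertex v)  = v
  realise (spare j t) = lookupOr (proj₁ (inhabited j)) (spares j) t

  part-realise : ∀ t → p (realise t) ≡ part t
  part-realise (vertex v)  = refl
  part-realise (spare j t) = lookupOr-All (spares j) t (proj₂ (inhabited j))
    (All.filter⁺ (λ v → ¬? (v ∈? vs)) (All.all-filter (λ v → p v ≟ᶠ j) (allFin n)))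

  realise-spare∉ : ∀ {j t} → t + count j vs ≤ k → realise (spare j t) ∉ vs
  realise-spare∉ {j} ok =
    proj₂ (∈-filter⁻ (λ v → ¬? (v ∈? vs)) {xs = members j} (lookupOr-∈ (spares j) (spares-long ok)))

  realise-injective : ∀ {s t} → Valid k vs s → Valid k vs t → realise s ≡ realise t → s ≡ t
  realise-injective {vertex u}  {vertex v}  _  _  u≡v = cong vertex u≡v
  realise-injective {vertex u}  {spare j t} u∈ ok u≡ = ⊥-elim (realise-spare∉ ok (subst (_∈ vs) u≡ u∈))
  realise-injective {spare j t} {vertex v}  ok v∈ ≡v =
    ⊥-elim (realise-spare∉ ok (subst (_∈ vs) (sym ≡v) v∈))
  realise-injective {spare i s} {spare j t} ok ok′ eq
    with refl ← trans (sym (part-realise (spare i s))) (trans (cong p eq) (part-realise (spare j t)))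
    = cong (spare i)
        (lookupOr-injective (Unique.filter⁺ _ (members-unique i)) (spares-long ok) (spares-long ok′) eq)

  realise-adjacent : ∀ s t → s — t → Adj G (realise s) (realise t)
  realise-adjacent s t s—t = Equivalence.from (adj (realise s) (realise t))
    (subst₂ (CyclicNeighbours (4 + m₀)) (sym (part-realise s)) (sym (part-realise t)) s—t)

  cycle : TokenCycle k vs → 3 ≤ length vs → ∃ λ c → IsCycle G c × vs ⊆ c
  cycle record { tokens = w ∷ ws ; closed = closed ; unique = unique ; visits = visits ; valid = valid }
        3≤|vs| =
    map realise (w ∷ ws) ,
    ( ≤-trans 3≤|vs| (begin
        length vs                  ≡⟨ length-map vertex vs ⟨
        length (map vertex vs)     ≤⟨ Sublist.length-mono-≤ visits ⟩
        length (w ∷ ws)            ≡⟨ length-map realise (w ∷ ws) ⟨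
        length (map realise (w ∷ ws)) ∎)
    , unique-map-on realise realise-injective valid unique
    , subst (Linked (Adj G)) (cong (realise w ∷_) (map-++ realise ws [ w ]))
        (Linked.map⁺ (Linked.map (λ {s} {t} → realise-adjacent s t) closed)) )
    , subst (_⊆ map realise (w ∷ ws)) (trans (sym (map-∘ vs)) (map-id vs)) (Sublist.map⁺ realise visits)
    where open ≤-Reasoning

corollary2p5 : (k : ℕ) → 1 ≤ k →
    (n : ℕ) (G : SimpleGraph n) (m : ℕ) (p : Fin n → Fin m) →
    IsBraceletPartition G m p → 4 ≤ m →
    (∀ i → suc k ≤ partSize p i) →
    IsOrdered (2 * k + 1) G
corollary2p5 k 1≤k n G m p (_ , inhabited , adj) (s≤s (s≤s (s≤s (s≤s {n = m₀} _)))) large vs len uvs =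
  Realisation.cycle G p adj inhabited large vs (Tokens.tokenCycle p k vs |vs| uvs)
    (subst (3 ≤_) (sym |vs|) (s≤s (+-mono-≤ 1≤k 1≤k)))
  where
  |vs| : length vs ≡ suc (k + k)
  |vs| = trans len (trans (+-comm (2 * k) 1) (cong (λ k′ → suc (k + k′)) (+-identityʳ k)))
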